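{- Let $k\ge3$. The only square factor (factor of the form $UU$ with $U$ nonempty) of $W^{(k)}_{2k-1}$ is the word $kk$ consisting of the digit $k$ twice.
   Context: Words are over $\mathbb{N}$. Define the morphism $\varphi_k$ by $\varphi_k(ki+j)=(ki)(ki+j+1)$ if $0\le j\le k-2$ and $\varphi_k(ki+j)=(ki+j+1)$ if $j=k-1$; let $W^{(k)}_n=\varphi_k^n(0)$. -}

module Defs where

open import Data.Nat using (ℕ; zero; suc; _+_; _*_; _∸_; NonZero)
open import Data.Nat.DivMod using (_/_; _%_)
open import Data.List using (List; []; _∷_; _++_; concatMap)
open import Data.Product using (Σ; _×_)
open import Relation.Binary.PropositionalEquality using (_≡_)
open import Relation.Nullary using (¬_)

φ-letter : (k : ℕ) → .{{_ : NonZero k}} → ℕ → List ℕ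
φ-letter k a with suc (a % k) Data.Nat.≟ k
... | Relation.Nullary.yes _ = suc a ∷ []
... | Relation.Nullary.no  _ = (k * (a / k)) ∷ suc a ∷ []

φ : (k : ℕ) → .{{_ : NonZero k}} → List ℕ → List ℕ
φ k w = concatMap (φ-letter k) w

φ^ : (k : ℕ) → .{{_ : NonZero k}} → ℕ → List ℕ → List ℕ
φ^ k zero    w = w
φ^ k (suc n) w = φ k (φ^ k n w)

W : (k : ℕ) → .{{_ : NonZero k}} → ℕ → List ℕ
W k n = φ^ k n (0 ∷ [])

IsFactor : List ℕ → List ℕ → Set
IsFactor x w = Σ (List ℕ) λ p → Σ (List ℕ) λ s → w ≡ p ++ x ++ s

HasSquareFactor : List ℕ → List ℕ → Set
HasSquareFactor w U = ¬ (U ≡ []) × IsFactor (U ++ U) w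

-- Every image φ(a) begins with a multiple of k, whereas the second letter
-- a + 1 of a two-letter image (k⌊a/k⌋)(a + 1) is not one. This synchronises φ: it is injective,
-- and every factorisation of φ(w) can be traced back to w. Hence a square UU in φ(w) comes from a
-- square of w or from a near square v a v e of w, where φ(a) = a + 1 and φ(e) = (a + 1)(e + 1).
-- The letters of W_n are at most n; a near square with v nonempty forces a + 1 ≥ 2k, and one
-- with v empty is a factor (k - 1) e with k - 1 ≤ e ≤ 2k - 2. Tracing factors j e of this kind
-- back through φ shows that they first appear in W_{j + k - 1}. So W_n is square-free for
-- n ≤ 2k - 2, and every square of W_{2k - 1} comes from the factor (k - 1) e of W_{2k - 2},
-- whose image contains kk.
module Submission where

open import Defs
open import Data.Nat
  using (ℕ; zero; suc; _+_; _*_; _∸_; _≤_; _<_; z≤n; s≤s; s≤s⁻¹; NonZero)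
open import Data.Nat.Properties
open import Data.Nat.DivMod
open import Data.Nat.Divisibility using (n∣m*n)
open import Data.List using (List; []; _∷_; _++_; _∷ʳ_; head; concat; map; initLast; _∷ʳ′_)
open import Data.List.Properties
  using (++-assoc; ++-identityʳ; ++-conicalˡ; ++-conicalʳ; ∷-injectiveˡ; ∷-injectiveʳ;
         ∷ʳ-injectiveʳ; map-++; concat-++)
open import Data.List.Relation.Unary.All using (All; []; _∷_)
import Data.List.Relation.Unary.All.Properties as All
open import Data.Maybe.Relation.Unary.All using (just; nothing; drop-just)
import Data.Maybe.Relation.Unary.All as Maybe
open import Data.Product using (∃; ∃₂; _×_; _,_; proj₁; proj₂)
import Data.Product as Product
open import Data.Sum using (_⊎_; inj₁; inj₂)
import Data.Sum as Sum
open import Data.Empty using (⊥-elim)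
open import Relation.Binary.PropositionalEquality
open import Relation.Nullary using (¬_; Dec; yes; no)

IsFactor-trans : ∀ {x y z} → IsFactor x y → IsFactor y z → IsFactor x z
IsFactor-trans {x} (p , s , refl) (p′ , s′ , refl) = p′ ++ p , s ++ s′ , reassociate
  where
  open ≡-Reasoning
  reassociate : p′ ++ (p ++ x ++ s) ++ s′ ≡ (p′ ++ p) ++ x ++ s ++ s′
  reassociate = begin
    p′ ++ (p ++ x ++ s) ++ s′   ≡⟨ cong (p′ ++_) (++-assoc p (x ++ s) s′) ⟩
    p′ ++ p ++ (x ++ s) ++ s′   ≡⟨ cong (λ t → p′ ++ p ++ t) (++-assoc x s s′) ⟩
    p′ ++ p ++ x ++ s ++ s′     ≡⟨ ++-assoc p′ p (x ++ s ++ s′) ⟨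
    (p′ ++ p) ++ x ++ s ++ s′   ∎

IsFactor-suffix : ∀ p x → IsFactor x (p ++ x)
IsFactor-suffix p x = p , [] , cong (p ++_) (sym (++-identityʳ x))

All-factor : ∀ {P : ℕ → Set} {x w} → IsFactor x w → All P w → All P x
All-factor {x = x} (p , s , refl) all = All.++⁻ˡ x (All.++⁻ʳ p all)

factor-of-singleton : ∀ {x t z} → IsFactor (x ∷ t) (z ∷ []) → t ≡ []
factor-of-singleton ([] , s , eq) = ++-conicalˡ _ s (sym (∷-injectiveʳ eq))
factor-of-singleton (_ ∷ p , s , eq) with () ← ++-conicalʳ p _ (sym (∷-injectiveʳ eq))

module Morphism (k₀ : ℕ) where

  k : ℕ
  k = 2 + k₀

  φ₁ : ℕ → List ℕ
  φ₁ = φ-letter k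

  Φ : List ℕ → List ℕ
  Φ = φ k

  Multiple : ℕ → Set
  Multiple c = c % k ≡ 0

  Multiple-k* : ∀ q → Multiple (k * q)
  Multiple-k* q = subst Multiple (*-comm q k) (m*n%n≡0 q k)

  k*[a/k]≤a : ∀ a → k * (a / k) ≤ a
  k*[a/k]≤a a = subst (_≤ a) (*-comm (a / k) k) (m/n*n≤m a k)

  k*q≡1+m⇒k≤1+m : ∀ q {m} → k * q ≡ suc m → k ≤ suc m
  k*q≡1+m⇒k≤1+m zero eq with () ← trans (sym (*-zeroʳ k)) eq
  k*q≡1+m⇒k≤1+m (suc q) eq = subst (k ≤_) eq (m≤m*n k (suc q))

  single-suc≡ : ∀ a → suc (a % k) ≡ k → suc a ≡ suc (a / k) * k
  single-suc≡ a last = trans (cong suc (m≡m%n+[m/n]*n a k)) (cong (_+ a / k * k) last)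

  single-suc-Multiple : ∀ a → suc (a % k) ≡ k → Multiple (suc a)
  single-suc-Multiple a last = subst Multiple (sym (single-suc≡ a last)) (m*n%n≡0 (suc (a / k)) k)

  single-¬Multiple : ∀ a → suc (a % k) ≡ k → ¬ Multiple a
  single-¬Multiple _ last mult with () ← trans (cong suc (sym mult)) last

  single-≥2k : ∀ a → suc (a % k) ≡ k → a / k ≢ 0 → k + k ≤ suc a
  single-≥2k a last q≢0 =
    subst (k + k ≤_) (sym (single-suc≡ a last)) (k+k≤[1+q]*k (a / k) q≢0)
    where
    k+k≤[1+q]*k : ∀ q → q ≢ 0 → k + k ≤ suc q * k
    k+k≤[1+q]*k zero q≢0 = ⊥-elim (q≢0 refl)
    k+k≤[1+q]*k (suc q) _ = +-monoʳ-≤ k (m≤m+n k (q * k))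

  single-<2k : ∀ a → suc (a % k) ≡ k → suc a < k + k → suc a ≡ k
  single-<2k a last lt with a / k ≟ 0
  ... | yes q≡0 =
    trans (single-suc≡ a last) (trans (cong (λ q → suc q * k) q≡0) (+-identityʳ k))
  ... | no q≢0 = ⊥-elim (<⇒≱ lt (single-≥2k a last q≢0))

  pair-suc-digits : ∀ a → suc (a % k) ≢ k → suc a % k ≡ suc (a % k) × suc a / k ≡ a / k
  pair-suc-digits a ¬last =
    subst (λ n → n % k ≡ suc r × n / k ≡ q) (sym (cong suc (m≡m%n+[m/n]*n a k)))
    ( trans ([m+kn]%n≡m%n (suc r) q k) (m<n⇒m%n≡m r<k)
    , trans (+-distrib-/-∣ʳ (suc r) (n∣m*n q)) (cong₂ _+_ (m<n⇒m/n≡0 r<k) (m*n/n≡m q k)))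
    where
    r q : ℕ
    r = a % k
    q = a / k
    r<k : suc r < k
    r<k = ≤∧≢⇒< (m%n<n a k) ¬last

  pair-suc-¬Multiple : ∀ a → suc (a % k) ≢ k → ¬ Multiple (suc a)
  pair-suc-¬Multiple a ¬last mult with () ← trans (sym (proj₁ (pair-suc-digits a ¬last))) mult

  data Shape (a : ℕ) : List ℕ → Set where
    single : suc (a % k) ≡ k → Shape a (suc a ∷ [])
    pair   : suc (a % k) ≢ k → Shape a (k * (a / k) ∷ suc a ∷ [])

  shape : ∀ a → Shape a (φ₁ a)
  shape a with suc (a % k) ≟ k
  ... | yes last = single last
  ... | no ¬last = pair ¬last

  φ₁-single : ∀ {a} → suc (a % k) ≡ k → φ₁ a ≡ suc a ∷ []
  φ₁-single {a} last with φ₁ a | shape a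
  ... | _ | single _ = refl
  ... | _ | pair ¬last = ⊥-elim (¬last last)

  φ₁-pair : ∀ {a} → suc (a % k) ≢ k → φ₁ a ≡ k * (a / k) ∷ suc a ∷ []
  φ₁-pair {a} ¬last with φ₁ a | shape a
  ... | _ | single last = ⊥-elim (¬last last)
  ... | _ | pair _ = refl

  φ₁-singleton : ∀ {a c} → φ₁ a ≡ c ∷ [] → suc a ≡ c × suc (a % k) ≡ k
  φ₁-singleton {a} eq with φ₁ a | shape a
  ... | _ | single last = ∷-injectiveˡ eq , last
  ... | _ | pair _ with () ← ∷-injectiveʳ eq

  φ₁-pair-base : ∀ {a b c} → φ₁ a ≡ b ∷ c ∷ [] → k * (a / k) ≡ b
  φ₁-pair-base {a} eq with φ₁ a | shape a
  ... | _ | single _ with () ← ∷-injectiveʳ eq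
  ... | _ | pair _ = ∷-injectiveˡ eq

  φ₁-suc : ∀ a → IsFactor (suc a ∷ []) (φ₁ a)
  φ₁-suc a with φ₁ a | shape a
  ... | _ | single _ = [] , [] , refl
  ... | _ | pair _ = k * (a / k) ∷ [] , [] , refl

  φ₁-small : ∀ {j} → j ≤ k₀ → φ₁ j ≡ 0 ∷ suc j ∷ []
  φ₁-small {j} j≤k₀ = trans (φ₁-pair ¬last) (cong (λ b → b ∷ suc j ∷ []) k*[j/k]≡0)
    where
    j<k : j < k
    j<k = m≤n⇒m≤1+n (s≤s j≤k₀)
    ¬last : suc (j % k) ≢ k
    ¬last eq =
      1+n≰n (subst (_≤ suc k₀) (trans (cong suc (sym (m<n⇒m%n≡m j<k))) eq) (s≤s j≤k₀))
    k*[j/k]≡0 : k * (j / k) ≡ 0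
    k*[j/k]≡0 = trans (cong (k *_) (m<n⇒m/n≡0 j<k)) (*-zeroʳ k)

  φ₁-k-1 : φ₁ (suc k₀) ≡ k ∷ []
  φ₁-k-1 = φ₁-single (cong suc (m<n⇒m%n≡m ≤-refl))

  φ₁-k : φ₁ k ≡ k ∷ suc k ∷ []
  φ₁-k = trans (φ₁-pair ¬last)
               (cong (λ b → b ∷ suc k ∷ []) (trans (cong (k *_) (n/n≡1 k)) (*-identityʳ k)))
    where
    ¬last : suc (k % k) ≢ k
    ¬last eq with () ← trans (cong suc (sym (n%n≡0 k))) eq

  φ₁-bound : ∀ {a n} → a ≤ n → All (_≤ suc n) (φ₁ a)
  φ₁-bound {a} a≤n with φ₁ a | shape a
  ... | _ | single _ = s≤s a≤n ∷ []
  ... | _ | pair _ = m≤n⇒m≤1+n (≤-trans (k*[a/k]≤a a) a≤n) ∷ s≤s a≤n ∷ []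

  φ₁≢[] : ∀ a → φ₁ a ≢ []
  φ₁≢[] a with φ₁ a | shape a
  ... | _ | single _ = λ ()
  ... | _ | pair _ = λ ()

  Φ-++ : ∀ u v → Φ (u ++ v) ≡ Φ u ++ Φ v
  Φ-++ u v = trans (cong concat (map-++ φ₁ u v)) (sym (concat-++ (map φ₁ u) (map φ₁ v)))

  Φ-factor : ∀ {x w} → IsFactor x w → IsFactor (Φ x) (Φ w)
  Φ-factor {x} (p , s , refl) = Φ p , Φ s , trans (Φ-++ p (x ++ s)) (cong (Φ p ++_) (Φ-++ x s))

  Φ-bound : ∀ {n w} → All (_≤ n) w → All (_≤ suc n) (Φ w)
  Φ-bound [] = []
  Φ-bound (a≤n ∷ all) = All.++⁺ (φ₁-bound a≤n) (Φ-bound all)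

  Φ-head-Multiple : ∀ u {c s} → Φ u ≡ c ∷ s → Multiple c
  Φ-head-Multiple (a ∷ u) eq with φ₁ a | shape a
  ... | _ | single last = subst Multiple (∷-injectiveˡ eq) (single-suc-Multiple a last)
  ... | _ | pair _ = subst Multiple (∷-injectiveˡ eq) (Multiple-k* (a / k))

  Φ-injective : ∀ u v → Φ u ≡ Φ v → u ≡ v
  Φ-injective [] [] _ = refl
  Φ-injective [] (b ∷ v) eq with () ← φ₁≢[] b (++-conicalˡ (φ₁ b) (Φ v) (sym eq))
  Φ-injective (a ∷ u) [] eq = sym (Φ-injective [] (a ∷ u) (sym eq))
  Φ-injective (a ∷ u) (b ∷ v) eq with φ₁ a | shape a | φ₁ b | shape b
  ... | _ | single _ | _ | single _ =
    cong₂ _∷_ (suc-injective (∷-injectiveˡ eq)) (Φ-injective u v (∷-injectiveʳ eq))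
  ... | _ | pair _ | _ | pair _ =
    cong₂ _∷_ (suc-injective (∷-injectiveˡ (∷-injectiveʳ eq)))
              (Φ-injective u v (∷-injectiveʳ (∷-injectiveʳ eq)))
  ... | _ | single _ | _ | pair ¬last =
    ⊥-elim (pair-suc-¬Multiple b ¬last (Φ-head-Multiple u (∷-injectiveʳ eq)))
  ... | _ | pair ¬last | _ | single _ =
    ⊥-elim (pair-suc-¬Multiple a ¬last (Φ-head-Multiple v (sym (∷-injectiveʳ eq))))

  Φ-one : ∀ u {c} → Φ u ≡ c ∷ [] → ∃ λ a → u ≡ a ∷ [] × φ₁ a ≡ c ∷ []
  Φ-one (a ∷ u) eq with φ₁ a in img | shape a
  ... | _ | single _ with Φ-injective u [] (∷-injectiveʳ eq)
  ...   | refl = a , refl , trans img (cong (_∷ []) (∷-injectiveˡ eq))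
  Φ-one (a ∷ u) eq | _ | pair _ with () ← ∷-injectiveʳ eq

  data Cut (w p s : List ℕ) : Set where
    between : ∀ w₁ w₂ → w ≡ w₁ ++ w₂ → Φ w₁ ≡ p → Φ w₂ ≡ s → Cut w p s
    inside  : ∀ w₁ x w₂ → suc (x % k) ≢ k → w ≡ w₁ ++ x ∷ w₂ →
              p ≡ Φ w₁ ∷ʳ k * (x / k) → s ≡ suc x ∷ Φ w₂ → Cut w p s

  Cut-∷ : ∀ {a w p q s} → φ₁ a ++ p ≡ q → Cut w p s → Cut (a ∷ w) q s
  Cut-∷ {a} refl (between w₁ w₂ refl refl refl) = between (a ∷ w₁) w₂ refl refl refl
  Cut-∷ {a} refl (inside w₁ x w₂ ¬last refl refl refl) =
    inside (a ∷ w₁) x w₂ ¬last refl (sym (++-assoc (φ₁ a) (Φ w₁) _)) refl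

  cut : ∀ w p s → Φ w ≡ p ++ s → Cut w p s
  cut [] p s eq =
    between [] [] refl (sym (++-conicalˡ p s (sym eq))) (sym (++-conicalʳ p s (sym eq)))
  cut (a ∷ w) [] s eq = between [] (a ∷ w) refl refl eq
  cut (a ∷ w) (c ∷ p) s eq with φ₁ a in img | shape a
  cut (a ∷ w) (c ∷ p) s eq | _ | single _ =
    Cut-∷ (trans (cong (_++ p) img) (cong (_∷ p) (∷-injectiveˡ eq))) (cut w p s (∷-injectiveʳ eq))
  cut (a ∷ w) (c ∷ []) s eq | _ | pair ¬last =
    inside [] a w ¬last refl (cong (_∷ []) (sym (∷-injectiveˡ eq))) (sym (∷-injectiveʳ eq))
  cut (a ∷ w) (c ∷ d ∷ p) s eq | _ | pair _ =
    Cut-∷ (trans (cong (_++ p) img)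
                 (cong₂ (λ x y → x ∷ y ∷ p) (∷-injectiveˡ eq)
                                            (∷-injectiveˡ (∷-injectiveʳ eq))))
          (cut w p s (∷-injectiveʳ (∷-injectiveʳ eq)))

  cut-at-multiple : ∀ w p s → Φ w ≡ p ++ s → Maybe.All Multiple (head s) →
                    ∃₂ λ w₁ w₂ → w ≡ w₁ ++ w₂ × Φ w₁ ≡ p × Φ w₂ ≡ s
  cut-at-multiple w p s eq mult with cut w p s eq
  ... | between w₁ w₂ w≡ e₁ e₂ = w₁ , w₂ , w≡ , e₁ , e₂
  ... | inside _ x _ ¬last _ _ refl = ⊥-elim (pair-suc-¬Multiple x ¬last (drop-just mult))

  cut-at-nonmultiple : ∀ w p c s → Φ w ≡ p ++ c ∷ s → ¬ Multiple c →
                       ∃₂ λ w₁ x → ∃ λ w₂ → suc (x % k) ≢ k × w ≡ w₁ ++ x ∷ w₂ ×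
                         p ≡ Φ w₁ ∷ʳ k * (x / k) × c ≡ suc x × s ≡ Φ w₂
  cut-at-nonmultiple w p c s eq ¬mult with cut w p (c ∷ s) eq
  ... | between _ w₂ _ _ e₂ = ⊥-elim (¬mult (Φ-head-Multiple w₂ e₂))
  ... | inside w₁ x w₂ ¬last w≡ p≡ e =
    w₁ , x , w₂ , ¬last , w≡ , p≡ , ∷-injectiveˡ e , ∷-injectiveʳ e

  Φ-last : ∀ u {q c} → Φ u ≡ q ∷ʳ c → ∃₂ λ u′ x → u ≡ u′ ∷ʳ x × c ≡ suc x
  Φ-last u {q} {c} eq with cut u q (c ∷ []) eq
  ... | between u₁ u₂ refl _ e₂ with Φ-one u₂ e₂
  ...   | x , refl , φx = u₁ , x , refl , sym (proj₁ (φ₁-singleton φx))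
  Φ-last u eq | inside u₁ x u₂ _ refl _ e₂ with Φ-injective u₂ [] (sym (∷-injectiveʳ e₂))
  ...   | refl = u₁ , x , refl , ∷-injectiveˡ e₂

  nonmultiple-origin : ∀ w {c} → IsFactor (c ∷ []) (Φ w) → ¬ Multiple c →
                       ∃ λ x → c ≡ suc x × IsFactor (x ∷ []) w
  nonmultiple-origin w {c} (p , s , eq) ¬mult with cut-at-nonmultiple w p c s eq ¬mult
  ... | w₁ , x , w₂ , _ , w≡ , _ , c≡ , _ = x , c≡ , w₁ , w₂ , w≡

  nonmultiple-predecessor : ∀ w {b c} → IsFactor (b ∷ c ∷ []) (Φ w) → ¬ Multiple c →
                            b ≡ k * (c / k)
  nonmultiple-predecessor w {b} {c} (p , s , eq) ¬mult
    with cut-at-nonmultiple w (p ∷ʳ b) c s (trans eq (sym (++-assoc p (b ∷ []) _))) ¬mult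
  ... | w₁ , x , _ , ¬last , _ , p≡ , refl , _ =
    trans (∷ʳ-injectiveʳ p (Φ w₁) p≡) (cong (k *_) (sym (proj₂ (pair-suc-digits x ¬last))))

  multiple-predecessor : ∀ w {b c} → IsFactor (b ∷ c ∷ []) (Φ w) → Multiple c →
                         ∃₂ λ x y → IsFactor (x ∷ y ∷ []) w × b ≡ suc x ×
                           ∃ λ t → φ₁ y ≡ c ∷ t
  multiple-predecessor w {b} {c} (p , s , eq) mult
    with cut-at-multiple w (p ∷ʳ b) (c ∷ s) (trans eq (sym (++-assoc p (b ∷ []) _))) (just mult)
  ... | w₁ , [] , _ , _ , ()
  ... | w₁ , y ∷ w₂ , refl , e₁ , e₂ with Φ-last w₁ e₁
  ...   | u , x , refl , b≡ =
    x , y , (u , w₂ , ++-assoc u (x ∷ []) (y ∷ w₂)) , b≡ , head-of-φ₁ e₂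
    where
    head-of-φ₁ : ∀ {t} → φ₁ y ++ Φ w₂ ≡ c ∷ t → ∃ λ t′ → φ₁ y ≡ c ∷ t′
    head-of-φ₁ e with φ₁ y | shape y
    ... | _ | single _ = [] , cong (_∷ []) (∷-injectiveˡ e)
    ... | _ | pair _ = suc y ∷ [] , cong (_∷ suc y ∷ []) (∷-injectiveˡ e)

  W-bound : ∀ n → All (_≤ n) (W k n)
  W-bound zero = z≤n ∷ []
  W-bound (suc n) = Φ-bound (W-bound n)

  W-letter-bound : ∀ n {x} → IsFactor (x ∷ []) (W k n) → x ≤ n
  W-letter-bound n f with All-factor f (W-bound n)
  ... | x≤n ∷ [] = x≤n

  n-occurs-in-W : ∀ n → IsFactor (n ∷ []) (W k n)
  n-occurs-in-W zero = [] , [] , refl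
  n-occurs-in-W (suc n) =
    IsFactor-trans (subst (IsFactor (suc n ∷ [])) (sym (++-identityʳ (φ₁ n))) (φ₁-suc n))
                   (Φ-factor (n-occurs-in-W n))

  -- The letters y whose image begins with k are exactly those with k - 1 ≤ y ≤ 2k - 2.
  FollowedByK : ℕ → List ℕ → Set
  FollowedByK m w = ∃₂ λ y t → φ₁ y ≡ k ∷ t × IsFactor (m ∷ y ∷ []) w

  φ₁≡k∷⇒k≤1+y : ∀ {y t} → φ₁ y ≡ k ∷ t → k ≤ suc y
  φ₁≡k∷⇒k≤1+y {y} eq with φ₁ y | shape y
  ... | _ | single _ = ≤-reflexive (sym (∷-injectiveˡ eq))
  ... | _ | pair _ = m≤n⇒m≤1+n (subst (_≤ y) (∷-injectiveˡ eq) (k*[a/k]≤a y))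

  φ₁≡k∷⇒Multiple⇒≡k : ∀ {y t} → φ₁ y ≡ k ∷ t → Multiple y → y ≡ k
  φ₁≡k∷⇒Multiple⇒≡k {y} eq mult with φ₁ y | shape y
  ... | _ | single last = ⊥-elim (single-¬Multiple y last mult)
  ... | _ | pair _ = begin
    y                 ≡⟨ m≡m%n+[m/n]*n y k ⟩
    y % k + y / k * k ≡⟨ cong₂ _+_ mult (cong (_* k) y/k≡1) ⟩
    k + 0             ≡⟨ +-identityʳ k ⟩
    k                 ∎
    where
    open ≡-Reasoning
    y/k≡1 : y / k ≡ 1
    y/k≡1 = *-cancelˡ-≡ (y / k) 1 k (trans (∷-injectiveˡ eq) (sym (*-identityʳ k)))

  FollowedByK-Φ : ∀ {w m} → m ≤ k₀ → FollowedByK m w → FollowedByK (suc m) (Φ w)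
  FollowedByK-Φ {m = m} m≤k₀ (y , t , φy , f) =
    k , suc k ∷ [] , φ₁-k , IsFactor-trans inner (Φ-factor f)
    where
    inner : IsFactor (suc m ∷ k ∷ []) (Φ (m ∷ y ∷ []))
    inner = 0 ∷ [] , t ++ [] , cong₂ (λ u v → u ++ v ++ []) (φ₁-small m≤k₀) φy

  FollowedByK-desubst : ∀ w {m} → suc m < k → FollowedByK (suc m) (Φ w) → FollowedByK m w
  FollowedByK-desubst w m<k (y , t , φy , f) with y % k ≟ 0
  ... | no ¬mult =
    ⊥-elim (<⇒≱ m<k (k*q≡1+m⇒k≤1+m (y / k) (sym (nonmultiple-predecessor w f ¬mult))))
  ... | yes mult with φ₁≡k∷⇒Multiple⇒≡k φy mult
  ...   | refl with multiple-predecessor w f mult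
  ...     | _ , y′ , f′ , refl , t′ , φy′ = y′ , t′ , φy′ , f′

  FollowedByK-W : ∀ j → j ≤ suc k₀ → FollowedByK j (W k (j + suc k₀))
  FollowedByK-W zero _ =
    suc k₀ , [] , φ₁-k-1 ,
    subst (λ x → IsFactor x (W k (suc k₀))) (cong (_++ []) (φ₁-small ≤-refl))
          (Φ-factor (n-occurs-in-W k₀))
  FollowedByK-W (suc j) j<k =
    FollowedByK-Φ (s≤s⁻¹ j<k) (FollowedByK-W j (m≤n⇒m≤1+n (s≤s⁻¹ j<k)))

  FollowedByK-W-bound : ∀ {m} n → m < k → FollowedByK m (W k n) → m + k ≤ suc n
  FollowedByK-W-bound zero _ (_ , _ , _ , f) with () ← factor-of-singleton f
  FollowedByK-W-bound {zero} (suc n) _ (y , t , φy , f) with y % k ≟ 0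
  ... | yes mult with multiple-predecessor (W k n) f mult
  ...   | _ , _ , _ , () , _
  FollowedByK-W-bound {zero} (suc n) _ (y , t , φy , f) | no ¬mult
    with nonmultiple-origin (W k n) (IsFactor-trans (IsFactor-suffix (0 ∷ []) (y ∷ [])) f) ¬mult
  ... | x , refl , g = ≤-trans (φ₁≡k∷⇒k≤1+y φy) (s≤s (s≤s (W-letter-bound n g)))
  FollowedByK-W-bound {suc m} (suc n) m<k fk =
    s≤s (FollowedByK-W-bound n (<-trans (n<1+n m) m<k) (FollowedByK-desubst (W k n) m<k fk))

  HasSquare : List ℕ → Set
  HasSquare w = ∃ (HasSquareFactor w)

  HasSquare-factor : ∀ {x w} → IsFactor x w → HasSquare x → HasSquare w
  HasSquare-factor f (V , V≢[] , g) = V , V≢[] , IsFactor-trans g f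

  -- Φ (v a v e) = Φ v (a + 1) Φ v (a + 1) (e + 1) contains the square of Φ v (a + 1).
  data NearSquareIn (w : List ℕ) : List ℕ → Set where
    nearSquare : ∀ v a e → φ₁ a ≡ suc a ∷ [] → φ₁ e ≡ suc a ∷ suc e ∷ [] →
                 IsFactor (v ++ a ∷ v ++ e ∷ []) w → NearSquareIn w (Φ v ∷ʳ suc a)

  NearSquareIn-factor : ∀ {x w U} → IsFactor x w → NearSquareIn x U → NearSquareIn w U
  NearSquareIn-factor f (nearSquare v a e φa φe g) = nearSquare v a e φa φe (IsFactor-trans g f)

  square-at-boundary : ∀ u w {U S} → U ≢ [] → Φ u ≡ U → Φ w ≡ U ++ S →
                       Maybe.All Multiple (head S) → HasSquare (u ++ w)
  square-at-boundary u w {U} {S} U≢[] eu ew mult with cut-at-multiple w U S ew mult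
  ... | u′ , w′ , refl , eu′ , _ with Φ-injective u′ u (trans eu′ (sym eu))
  ... | refl =
    u , (λ u≡[] → U≢[] (trans (sym eu) (cong Φ u≡[]))) , [] , w′ , sym (++-assoc u u w′)

  nearSquare-at-pair : ∀ u w {U h S} → Φ u ≡ U → Φ w ≡ U ++ h ∷ S → ¬ Multiple h →
                       NearSquareIn (u ++ w) U
  nearSquare-at-pair u w {U} {h} {S} eu ew ¬mult with cut-at-nonmultiple w U h S ew ¬mult
  ... | w₁ , x , w₂ , ¬last , refl , refl , refl , _
    with cut-at-multiple u (Φ w₁) (k * (x / k) ∷ []) eu (just (Multiple-k* (x / k)))
  ... | u₁ , u₂ , refl , eu₁ , eu₂ with Φ-injective u₁ w₁ eu₁ | Φ-one u₂ eu₂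
  ... | refl | a , refl , φa =
    subst (λ β → NearSquareIn ((w₁ ∷ʳ a) ++ w₁ ++ x ∷ w₂) (Φ w₁ ∷ʳ β)) 1+a≡β
      (nearSquare w₁ a x (trans φa (cong (_∷ []) (sym 1+a≡β)))
                         (trans (φ₁-pair ¬last) (cong (λ β → β ∷ suc x ∷ []) (sym 1+a≡β)))
                         ([] , w₂ , reassociate))
    where
    open ≡-Reasoning
    1+a≡β : suc a ≡ k * (x / k)
    1+a≡β = proj₁ (φ₁-singleton φa)
    reassociate : (w₁ ∷ʳ a) ++ w₁ ++ x ∷ w₂ ≡ (w₁ ++ a ∷ w₁ ++ x ∷ []) ++ w₂
    reassociate = begin
      (w₁ ∷ʳ a) ++ w₁ ++ x ∷ w₂       ≡⟨ ++-assoc w₁ (a ∷ []) _ ⟩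
      w₁ ++ a ∷ w₁ ++ x ∷ w₂          ≡⟨ cong (λ t → w₁ ++ a ∷ t) (++-assoc w₁ (x ∷ []) w₂) ⟨
      w₁ ++ a ∷ (w₁ ++ x ∷ []) ++ w₂  ≡⟨ ++-assoc w₁ (a ∷ w₁ ++ x ∷ []) w₂ ⟨
      (w₁ ++ a ∷ w₁ ++ x ∷ []) ++ w₂  ∎

  square-or-nearSquare : ∀ u w {U} S → U ≢ [] → Φ u ≡ U → Φ w ≡ U ++ S →
                         HasSquare (u ++ w) ⊎ NearSquareIn (u ++ w) U
  square-or-nearSquare u w [] U≢[] eu ew = inj₁ (square-at-boundary u w U≢[] eu ew nothing)
  square-or-nearSquare u w (h ∷ S) U≢[] eu ew with h % k ≟ 0
  ... | yes mult = inj₁ (square-at-boundary u w U≢[] eu ew (just mult))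
  ... | no ¬mult = inj₂ (nearSquare-at-pair u w eu ew ¬mult)

  square-at-pairs : ∀ w {P c U} S → ¬ Multiple c → Φ w ≡ P ++ ((c ∷ U) ++ (c ∷ U)) ++ S →
                    HasSquare w
  square-at-pairs w {P} {c} {U} S ¬mult eq
    with cut-at-nonmultiple w P c (U ++ c ∷ U ++ S)
           (trans eq (cong (λ t → P ++ c ∷ t) (++-assoc U (c ∷ U) S))) ¬mult
  ... | w₁ , x , w₂ , _ , refl , _ , refl , e₂
    with cut-at-nonmultiple w₂ U (suc x) (U ++ S) (sym e₂) ¬mult
  ... | w₃ , _ , w₄ , _ , refl , refl , refl , e₄
    with cut-at-multiple w₄ (Φ w₃) (k * (x / k) ∷ S) (trans (sym e₄) (++-assoc (Φ w₃) _ S))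
           (just (Multiple-k* (x / k)))
  ... | w₅ , w₆ , refl , e₅ , _ with Φ-injective w₅ w₃ e₅
  ... | refl =
    x ∷ w₃ , (λ ()) , w₁ , w₆ , cong (λ t → w₁ ++ x ∷ t) (sym (++-assoc w₃ (x ∷ w₃) w₆))

  square-desubstitution : ∀ w U → HasSquareFactor (Φ w) U → HasSquare w ⊎ NearSquareIn w U
  square-desubstitution w [] (U≢[] , _) = ⊥-elim (U≢[] refl)
  square-desubstitution w (c ∷ U) (U≢[] , P , S , eq) with c % k ≟ 0
  ... | no ¬mult = inj₁ (square-at-pairs w S ¬mult eq)
  ... | yes mult
    with cut-at-multiple w P ((c ∷ U) ++ (c ∷ U) ++ S)
           (trans eq (cong (P ++_) (++-assoc (c ∷ U) (c ∷ U) S))) (just mult)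
  ... | w₁ , w₂ , refl , _ , e₂ with cut-at-multiple w₂ (c ∷ U) ((c ∷ U) ++ S) e₂ (just mult)
  ... | u , w₃ , refl , eu , e₃ =
    Sum.map (HasSquare-factor (IsFactor-suffix w₁ _)) (NearSquareIn-factor (IsFactor-suffix w₁ _))
            (square-or-nearSquare u w₃ S U≢[] eu e₃)

  shared-predecessor-bound : ∀ w {β a e} → φ₁ a ≡ suc a ∷ [] → φ₁ e ≡ suc a ∷ suc e ∷ [] →
                             IsFactor (β ∷ a ∷ []) (Φ w) → IsFactor (β ∷ e ∷ []) (Φ w) →
                             k + k ≤ suc a
  shared-predecessor-bound w {β} {a} {e} φa φe βa βe = by-cases (e % k ≟ 0)
    where
    last : suc (a % k) ≡ k
    last = proj₂ (φ₁-singleton φa)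
    β≡k*[a/k] : β ≡ k * (a / k)
    β≡k*[a/k] = nonmultiple-predecessor w βa (single-¬Multiple a last)
    by-cases : Dec (Multiple e) → k + k ≤ suc a
    by-cases (no ¬mult) = ⊥-elim (1+n≰n (subst (_≤ a) k*[a/k]≡1+a (k*[a/k]≤a a)))
      where
      k*[a/k]≡1+a : k * (a / k) ≡ suc a
      k*[a/k]≡1+a =
        trans (sym β≡k*[a/k]) (trans (nonmultiple-predecessor w βe ¬mult) (φ₁-pair-base φe))
    by-cases (yes mult) with multiple-predecessor w βe mult
    ... | _ , _ , _ , β≡1+x , _ = single-≥2k a last a/k≢0
      where
      a/k≢0 : a / k ≢ 0
      a/k≢0 q≡0 =
        0≢1+n (trans (sym (trans (cong (k *_) q≡0) (*-zeroʳ k))) (trans (sym β≡k*[a/k]) β≡1+x))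

  shared-predecessor-in-W : ∀ n {β a e} → φ₁ a ≡ suc a ∷ [] → φ₁ e ≡ suc a ∷ suc e ∷ [] →
                            IsFactor (β ∷ a ∷ []) (W k n) → IsFactor (β ∷ e ∷ []) (W k n) →
                            k + k ≤ suc n
  shared-predecessor-in-W zero _ _ βa _ with () ← factor-of-singleton βa
  shared-predecessor-in-W (suc n) {β} φa φe βa βe =
    ≤-trans (shared-predecessor-bound (W k n) φa φe βa βe)
            (s≤s (W-letter-bound (suc n) (IsFactor-trans (β ∷ [] , [] , refl) βa)))

  adjacent-pair-in-W : ∀ {n a e} → suc n < k + k →
                       φ₁ a ≡ suc a ∷ [] → φ₁ e ≡ suc a ∷ suc e ∷ [] →
                       IsFactor (a ∷ e ∷ []) (W k n) → suc a ≡ k × k + k ≤ suc (suc n)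
  adjacent-pair-in-W {n} {a} {e} lt φa φe f with single-<2k a (proj₂ (φ₁-singleton φa)) 1+a<2k
    where
    1+a<2k : suc a < k + k
    1+a<2k = ≤-<-trans (s≤s (W-letter-bound n (IsFactor-trans ([] , e ∷ [] , refl) f))) lt
  ... | refl = refl , s≤s (FollowedByK-W-bound n ≤-refl (e , suc e ∷ [] , φe , f))

  nearSquare-in-W : ∀ {n U} → suc n < k + k → NearSquareIn (W k n) U →
                    U ≡ k ∷ [] × k + k ≤ suc (suc n)
  nearSquare-in-W {n} lt (nearSquare v a e φa φe f) with initLast v
  ... | [] = Product.map₁ (cong (_∷ [])) (adjacent-pair-in-W lt φa φe f)
  ... | v₀ ∷ʳ′ β = ⊥-elim (<⇒≱ lt (shared-predecessor-in-W n φa φe βa βe))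
    where
    βa : IsFactor (β ∷ a ∷ []) (W k n)
    βa = IsFactor-trans (v₀ , (v₀ ∷ʳ β) ++ e ∷ [] , ++-assoc v₀ (β ∷ []) _) f
    βe : IsFactor (β ∷ e ∷ []) (W k n)
    βe = IsFactor-trans (v₀ , [] , ++-assoc v₀ (β ∷ []) (e ∷ []))
           (IsFactor-trans (IsFactor-suffix (a ∷ []) _)
                           (IsFactor-trans (IsFactor-suffix (v₀ ∷ʳ β) _) f))

  W-square-free : ∀ n → suc n < k + k → ¬ HasSquare (W k n)
  W-square-free zero _ ([] , []≢[] , _) = []≢[] refl
  W-square-free zero _ (c ∷ U , _ , f) with () ← ++-conicalʳ U _ (factor-of-singleton f)
  W-square-free (suc n) lt (U , sq) with square-desubstitution (W k n) U sq
  ... | inj₁ square = W-square-free n (<-trans (n<1+n (suc n)) lt) square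
  ... | inj₂ near = <⇒≱ lt (proj₂ (nearSquare-in-W (<-trans (n<1+n (suc n)) lt) near))

  2k∸1≡ : 2 * k ∸ 1 ≡ suc (suc k₀ + suc k₀)
  2k∸1≡ = cong suc (trans (cong (k₀ +_) (+-identityʳ k)) (+-suc k₀ (suc k₀)))

  2k-1<2k : suc (suc k₀ + suc k₀) < k + k
  2k-1<2k = s≤s (s≤s (+-monoʳ-< k₀ (n<1+n (suc k₀))))

  only-square : ∀ U → HasSquareFactor (W k (2 * k ∸ 1)) U → U ≡ k ∷ []
  only-square U sq
    with square-desubstitution (W k (suc k₀ + suc k₀)) U
           (subst (λ n → HasSquareFactor (W k n) U) 2k∸1≡ sq)
  ... | inj₁ square = ⊥-elim (W-square-free _ 2k-1<2k square)
  ... | inj₂ near = proj₁ (nearSquare-in-W 2k-1<2k near)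

  kk-factor : IsFactor (k ∷ k ∷ []) (W k (2 * k ∸ 1))
  kk-factor with FollowedByK-W (suc k₀) ≤-refl
  ... | y , t , φy , f =
    subst (λ n → IsFactor (k ∷ k ∷ []) (W k n)) (sym 2k∸1≡)
      (IsFactor-trans ([] , t ++ [] , cong₂ (λ u v → u ++ v ++ []) φ₁-k-1 φy) (Φ-factor f))

open Morphism using (kk-factor; only-square)

-- The argument only needs k ≥ 2.
lemma18 : (k : ℕ) → .{{_ : NonZero k}} → 3 ≤ k →
    IsFactor (k ∷ k ∷ []) (W k (2 * k ∸ 1))
      × (∀ (U : List ℕ) → HasSquareFactor (W k (2 * k ∸ 1)) U → U ≡ k ∷ [])
lemma18 (suc zero) (s≤s ())
lemma18 (suc (suc k₀)) _ = kk-factor k₀ , only-square k₀
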